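{- Let $n\ge 3$ and $n\ge m\ge 2$, and let $f\colon V(K_m)\to V(K_n)$ be any function. Then $\alpha_2(K_m\otimes_f K_n)=m$.
   Context: For graphs $G$ and $H$ and a function $f\colon V(G)\to V(H)$, the Sierpiński product $G\otimes_f H$ is the graph with vertex set $V(G)\times V(H)$ whose edges are: $(g,h)(g,h')$ for every $g\in V(G)$ and every edge $hh'\in E(H)$; and $(g,f(g'))(g',f(g))$ for every edge $gg'\in E(G)$. A $2$-packing of a graph $X$ is a set $S\subseteq V(X)$ such that every two distinct vertices of $S$ are at shortest-path distance at least $3$; $\alpha_2(X)$ is the maximum cardinality of a $2$-packing of $X$. $K_m$ denotes the complete graph on $m$ vertices. -}

module Defs where

open import Data.Nat using (ℕ; zero; suc; _<_)
open import Data.Fin using (Fin)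
open import Data.Product using (_×_; _,_)
open import Data.List using (List; length)
open import Data.List.Membership.Propositional using (_∈_)
open import Data.List.Relation.Unary.Unique.Propositional using (Unique)
open import Relation.Binary.PropositionalEquality using (_≡_; _≢_)
open import Relation.Nullary using (¬_)

record Graph : Set₁ where
  field
    V   : Set
    Adj : V → V → Set
open Graph public

K : ℕ → Graph
K m = record { V = Fin m ; Adj = λ i j → i ≢ j }

data SAdj (G H : Graph) (f : V G → V H) : V G × V H → V G × V H → Set where
  inner  : ∀ {g h h'} → Adj H h h' → SAdj G H f (g , h) (g , h')
  bridge : ∀ {g g'} → Adj G g g' → SAdj G H f (g , f g') (g' , f g)

Sierpinski : (G H : Graph) → (V G → V H) → Graph
Sierpinski G H f = record { V = V G × V H ; Adj = SAdj G H f }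

data Walk (X : Graph) : V X → V X → ℕ → Set where
  nil  : ∀ {u} → Walk X u u zero
  cons : ∀ {u w v k} → Adj X u w → Walk X w v k → Walk X u v (suc k)

DistAtLeast : (X : Graph) → V X → V X → ℕ → Set
DistAtLeast X u v d = ∀ k → k < d → ¬ Walk X u v k

Is2Packing : (X : Graph) → List (V X) → Set
Is2Packing X S = Unique S × (∀ {u v} → u ∈ S → v ∈ S → u ≢ v → DistAtLeast X u v 3)

α₂≡ : Graph → ℕ → Set
α₂≡ X a =
  (Data.Product.Σ (List (V X)) λ S → Is2Packing X S × length S ≡ a) ×
  (∀ S → Is2Packing X S → Data.Nat._≤_ (length S) a)

{-# OPTIONS --safe #-}
-- A vertex (g , x) of G ⊗_f H with x ∉ f[N(g)] lies on no bridge edge, so all its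
-- neighbours stay in the copy g; two such vertices in different copies are therefore at
-- distance at least 3.  For G = K_m, H = K_n and m ≤ n, the m - 1 values f g' (g' ≠ g) leave
-- a free x in every copy g, which gives a 2-packing of size m.  Conversely the copies of K_n
-- are cliques, so a 2-packing meets each of the m copies at most once.
module Submission where

open import Defs
open import Data.Nat using (ℕ; suc; _≤_; _<_; s≤s; z≤n)
open import Data.Nat.Properties using (<⇒≱)
open import Data.Fin using (Fin; _≟_; punchIn; punchOut)
open import Data.Fin.Properties using (any?; all?; ¬∀⟶∃¬; injective⇒≤; punchIn-punchOut)
open import Data.Product using (∃; _×_; _,_; proj₁; proj₂; map₂)
open import Data.Product.Properties using (,-injectiveˡ)
open import Data.List using (List; length; map; lookup; allFin)
open import Data.List.Properties using (length-map; length-tabulate)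
open import Data.List.Membership.Propositional using (_∈_)
open import Data.List.Membership.Propositional.Properties using (∈-lookup; ∈-map⁻)
open import Data.List.Relation.Unary.All as All using ()
open import Data.List.Relation.Unary.AllPairs using (_∷_)
open import Data.List.Relation.Unary.Unique.Propositional using (Unique)
open import Data.List.Relation.Unary.Unique.Propositional.Properties using (map⁺; allFin⁺)
open import Relation.Binary.PropositionalEquality
open import Relation.Nullary using (¬_; yes; no; ¬?; contradiction)
open import Relation.Nullary.Decidable using (decidable-stable)
open import Function using (_∘_)

lookup-injective : ∀ {A : Set} {xs : List A} → Unique xs →
  ∀ {i j} → lookup xs i ≡ lookup xs j → i ≡ j
lookup-injective (_ ∷ _)   {Fin.zero}  {Fin.zero}  _  =
  refl
lookup-injective (x∉ ∷ _)  {Fin.zero}  {Fin.suc j} eq =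
  contradiction eq (All.lookup x∉ (∈-lookup j))
lookup-injective (x∉ ∷ _)  {Fin.suc i} {Fin.zero}  eq =
  contradiction (sym eq) (All.lookup x∉ (∈-lookup i))
lookup-injective (_ ∷ xs!) {Fin.suc i} {Fin.suc j} eq =
  cong Fin.suc (lookup-injective xs! eq)

length≤-injectiveOn : ∀ {A : Set} {m} (p : A → Fin m) {xs : List A} → Unique xs →
  (∀ {u v} → u ∈ xs → v ∈ xs → p u ≡ p v → u ≡ v) → length xs ≤ m
length≤-injectiveOn p xs! p-inj =
  injective⇒≤ (lookup-injective xs! ∘ p-inj (∈-lookup _) (∈-lookup _))

missed-value : ∀ {k n} → k < n → (f : Fin k → Fin n) → ∃ λ y → ∀ i → f i ≢ y
missed-value k<n f with any? (λ y → all? (λ i → ¬? (f i ≟ y)))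
... | yes missed = missed
... | no ¬missed = contradiction (injective⇒≤ preimage-injective) (<⇒≱ k<n)
  where
  preimage : ∀ y → ∃ λ i → f i ≡ y
  preimage y = map₂ (decidable-stable (f _ ≟ y))
    (¬∀⟶∃¬ _ _ (λ i → ¬? (f i ≟ y)) (λ ∀i → ¬missed (y , ∀i)))

  preimage-injective : ∀ {y y'} → proj₁ (preimage y) ≡ proj₁ (preimage y') → y ≡ y'
  preimage-injective {y} {y'} eq =
    trans (sym (proj₂ (preimage y))) (trans (cong f eq) (proj₂ (preimage y')))

value-avoiding-others : ∀ {m n} → m ≤ n → (f : Fin m → Fin n) (g : Fin m) →
  ∃ λ y → ∀ {g'} → g ≢ g' → y ≢ f g'
value-avoiding-others {suc _} m≤n f g with missed-value m≤n (f ∘ punchIn g)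
... | y , missed = y , λ g≢g' y≡fg' →
  missed (punchOut g≢g') (trans (cong f (punchIn-punchOut g≢g')) (sym y≡fg'))

transversal : ∀ {A B : Set} → (A → B) → List A → List (A × B)
transversal h = map (λ a → a , h a)

module _ (X : Graph) {S : List (V X)} (packing : Is2Packing X S) where

  packing-nonadjacent : ∀ {u v} → u ∈ S → v ∈ S → u ≢ v → ¬ Adj X u v
  packing-nonadjacent u∈ v∈ u≢v uv = proj₂ packing u∈ v∈ u≢v
    1 (s≤s (s≤s z≤n)) (cons uv nil)

module _ (G : Graph) {n} (f : V G → Fin n)
         {S} (packing : Is2Packing (Sierpinski G (K n) f) S) where

  packing-meets-copy-once : ∀ {u v} → u ∈ S → v ∈ S → proj₁ u ≡ proj₁ v → u ≡ v
  packing-meets-copy-once {g , x} {.g , y} u∈ v∈ refl with x ≟ y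
  ... | yes refl = refl
  ... | no x≢y  = contradiction (inner x≢y)
    (packing-nonadjacent (Sierpinski G (K n) f) packing u∈ v∈ (x≢y ∘ cong proj₂))

module _ (G H : Graph)
         (Adj-sym : ∀ {g g'} → Adj G g g' → Adj G g' g) (f : V G → V H) where

  BridgeFree : V G × V H → Set
  BridgeFree (g , x) = ∀ {g'} → Adj G g g' → x ≢ f g'

  edge-from-bridgeFree : ∀ {u w} → BridgeFree u → SAdj G H f u w → proj₁ w ≡ proj₁ u
  edge-from-bridgeFree bf (inner _)  = refl
  edge-from-bridgeFree bf (bridge a) = contradiction refl (bf a)

  edge-into-bridgeFree : ∀ {w v} → BridgeFree v → SAdj G H f w v → proj₁ w ≡ proj₁ v
  edge-into-bridgeFree bf (inner _)  = refl
  edge-into-bridgeFree bf (bridge a) = contradiction refl (bf (Adj-sym a))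

  bridgeFree-far : ∀ {u v} → BridgeFree u → BridgeFree v → proj₁ u ≢ proj₁ v →
    DistAtLeast (Sierpinski G H f) u v 3
  bridgeFree-far bu bv g≢g' _ _ nil = g≢g' refl
  bridgeFree-far bu bv g≢g' _ _ (cons uv nil) = g≢g' (sym (edge-from-bridgeFree bu uv))
  bridgeFree-far bu bv g≢g' _ _ (cons uw (cons wv nil)) =
    g≢g' (trans (sym (edge-from-bridgeFree bu uw)) (edge-into-bridgeFree bv wv))
  bridgeFree-far bu bv g≢g' _ (s≤s (s≤s (s≤s ()))) (cons _ (cons _ (cons _ _)))

  transversal-2packing : (h : V G → V H) → (∀ g → BridgeFree (g , h g)) →
    ∀ {gs} → Unique gs → Is2Packing (Sierpinski G H f) (transversal h gs)
  transversal-2packing h bf {gs} gs! = map⁺ ,-injectiveˡ gs! , far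
    where
    far : ∀ {u v} → u ∈ transversal h gs → v ∈ transversal h gs → u ≢ v →
      DistAtLeast (Sierpinski G H f) u v 3
    far u∈ v∈ u≢v with ∈-map⁻ (λ g → g , h g) u∈ | ∈-map⁻ (λ g → g , h g) v∈
    ... | g , _ , refl | g' , _ , refl =
      bridgeFree-far (bf g) (bf g') (λ { refl → u≢v refl })

lemma3p2 : (m n : ℕ) → 3 ≤ n → 2 ≤ m → m ≤ n → (f : Fin m → Fin n) →
    α₂≡ (Sierpinski (K m) (K n) f) m
lemma3p2 m n _ _ m≤n f =
  (transversal h (allFin m) , packing , length-transversal) , upper
  where
  h : Fin m → Fin n
  h g = proj₁ (value-avoiding-others m≤n f g)

  packing : Is2Packing (Sierpinski (K m) (K n) f) (transversal h (allFin m))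
  packing = transversal-2packing (K m) (K n) ≢-sym f h
    (proj₂ ∘ value-avoiding-others m≤n f) (allFin⁺ m)

  length-transversal : length (transversal h (allFin m)) ≡ m
  length-transversal = trans (length-map _ (allFin m)) (length-tabulate _)

  upper : ∀ S → Is2Packing (Sierpinski (K m) (K n) f) S → length S ≤ m
  upper S p = length≤-injectiveOn proj₁ (proj₁ p) (packing-meets-copy-once (K m) f p)
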